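{- Let $G=(V,E)$ be a simple graph, let $k=2r\ge3$ be an even integer and let $s$ be an integer with $1\le s<\frac{k}{2}$. Let $\mathscr{L}^{k,s}$ and $\mathscr{Q}^{k,s}$ be the Laplacian and signless Laplacian tensors of the generalized power hypergraph $G^{k,s}$. Then $\lambda(\mathscr{L}^{k,s})=\lambda(\mathscr{Q}^{k,s})$.
   Context: Generalized power hypergraph: for a simple graph $G=(V,E)$, an integer $k\ge2$ and $1\le s\le k/2$, $G^{k,s}$ is the $k$-uniform hypergraph obtained by taking, for each $v\in V$, a set $V_v$ of $s$ new vertices and, for each $e\in E$, a set $V_e$ of $k-2s$ new vertices (all these sets pairwise disjoint), with vertex set $\bigcup_{v}V_v\cup\bigcup_e V_e$ and edge set $\{V_u\cup V_v\cup V_e: e=uv\in E\}$. For a $k$-uniform hypergraph $\mathscr{H}$ on vertex set $[N]$, the adjacency tensor $\mathscr{A}(\mathscr{H})$ is the order $k$ dimension $N$ tensor with $a_{i_1\cdots i_k}=\frac{1}{(k-1)!}$ if $\{i_1,\dots,i_k\}$ is an edge and $0$ otherwise; $\mathscr{D}(\mathscr{H})$ is the diagonal order $k$ tensor whose diagonal entries are the vertex degrees (number of edges containing the vertex); $\mathscr{L}(\mathscr{H})=\mathscr{D}(\mathscr{H})-\mathscr{A}(\mathscr{H})$ and $\mathscr{Q}(\mathscr{H})=\mathscr{D}(\mathscr{H})+\mathscr{A}(\mathscr{H})$. For an order $k$ dimension $N$ tensor $\mathscr{T}$, $(\mathscr{T}x)_i=\sum_{i_2,\dots,i_k}t_{ii_2\cdots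 i_k}x_{i_2}\cdots x_{i_k}$; $\lambda\in\mathbb{R}$ is an $H$-eigenvalue if $\mathscr{T}x=\lambda(x_1^{k-1},\dots,x_N^{k-1})^T$ for some nonzero real $x$, and $\lambda(\mathscr{T})$ is the largest $H$-eigenvalue. -}

module Defs where

open import Level using (Level; _⊔_)
open import Data.Nat as ℕ using (ℕ; zero; suc; _∸_)
open import Data.Fin as Fin using (Fin; splitAt; remQuot)
open import Data.Fin.Properties using (_≟_)
open import Data.Bool using (Bool; true; false; if_then_else_; _∧_; _∨_)
open import Data.Vec using (Vec; []; _∷_)
open import Data.Sum using (_⊎_; inj₁; inj₂)
open import Data.Product using (Σ; ∃; _×_; _,_; proj₁; proj₂)
open import Relation.Nullary using (¬_)
open import Relation.Nullary.Decidable using (⌊_⌋)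
open import Relation.Binary.PropositionalEquality using (_≡_)
open import Relation.Binary.Structures using (IsTotalOrder)
open import Algebra.Bundles using (CommutativeRing)

record RealField (c ℓ : Level) : Set (Level.suc (c ⊔ ℓ)) where
  field
    commRing : CommutativeRing c ℓ
  open CommutativeRing commRing public
  field
    _≤_           : Carrier → Carrier → Set ℓ
    isTotalOrder  : IsTotalOrder _≈_ _≤_
    +-mono        : ∀ {x y} z → x ≤ y → (x + z) ≤ (y + z)
    *-nonneg      : ∀ {x y} → 0# ≤ x → 0# ≤ y → 0# ≤ (x * y)
    1≉0           : ¬ (1# ≈ 0#)
    _⁻¹           : Carrier → Carrier
    inverse       : ∀ x → ¬ (x ≈ 0#) → (x * (x ⁻¹)) ≈ 1#
    complete      : (P : Carrier → Set (c ⊔ ℓ)) → ∃ P →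
                    ∃ (λ b → ∀ y → P y → y ≤ b) →
                    ∃ (λ s → (∀ y → P y → y ≤ s) ×
                             (∀ b → (∀ y → P y → y ≤ b) → s ≤ b))

record SimpleGraph : Set where
  field
    n m    : ℕ
    ends   : Fin m → Fin n × Fin n
    loopless : ∀ e → ¬ (proj₁ (ends e) ≡ proj₂ (ends e))
    simple : ∀ e f → ((proj₁ (ends e) ≡ proj₁ (ends f)) × (proj₂ (ends e) ≡ proj₂ (ends f)))
                     ⊎ ((proj₁ (ends e) ≡ proj₂ (ends f)) × (proj₂ (ends e) ≡ proj₁ (ends f)))
                   → e ≡ f

record Hypergraph : Set where
  field
    N M  : ℕ
    edge : Fin M → Fin N → Bool

_==_ : ∀ {n} → Fin n → Fin n → Bool
i == j = ⌊ i ≟ j ⌋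

-- Generalized power hypergraph G^{k,s} with t = k - 2s.
-- Vertex set: Fin (n * s + m * t); the first block is ⋃_v V_v
-- (vertex (v , a) ↦ combine v a), the second block is ⋃_e V_e.
powerHG : SimpleGraph → (k s : ℕ) → Hypergraph
powerHG G k s = record { N = n ℕ.* s ℕ.+ m ℕ.* t ; M = m ; edge = mem }
  where
  open SimpleGraph G
  t = k ∸ (2 ℕ.* s)
  mem : Fin m → Fin (n ℕ.* s ℕ.+ m ℕ.* t) → Bool
  mem e w with splitAt (n ℕ.* s) w
  ... | inj₁ p = (proj₁ (remQuot {n} s p) == proj₁ (ends e))
                 ∨ (proj₁ (remQuot {n} s p) == proj₂ (ends e))
  ... | inj₂ q = proj₁ (remQuot {m} t q) == e

module _ {c ℓ} (R : RealField c ℓ) where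
  open RealField R

  ΣFin : (n : ℕ) → (Fin n → Carrier) → Carrier
  ΣFin zero    f = 0#
  ΣFin (suc n) f = f Fin.zero + ΣFin n (λ i → f (Fin.suc i))

  ΣIdx : (N m : ℕ) → (Vec (Fin N) m → Carrier) → Carrier
  ΣIdx N zero    f = f []
  ΣIdx N (suc m) f = ΣFin N (λ i → ΣIdx N m (λ v → f (i ∷ v)))

  prodIdx : ∀ {N m} → (Fin N → Carrier) → Vec (Fin N) m → Carrier
  prodIdx x []       = 1#
  prodIdx x (i ∷ is) = x i * prodIdx x is

  pow : Carrier → ℕ → Carrier
  pow a zero    = 1#
  pow a (suc n) = a * pow a n

  fromℕ : ℕ → Carrier
  fromℕ zero    = 0#
  fromℕ (suc n) = 1# + fromℕ n

  Tensor : ℕ → ℕ → Set c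
  Tensor k N = Vec (Fin N) k → Carrier

  apply : ∀ {k N} → Tensor k N → (Fin N → Carrier) → Fin N → Carrier
  apply {zero}  T x i = 0#
  apply {suc k} {N} T x i = ΣIdx N k (λ js → T (i ∷ js) * prodIdx x js)

  IsHEigenvalue : ∀ {k N} → Tensor k N → Carrier → Set (c ⊔ ℓ)
  IsHEigenvalue {k} {N} T λ′ =
    Σ (Fin N → Carrier) λ x → (∃ λ i → ¬ (x i ≈ 0#)) ×
      (∀ i → apply T x i ≈ (λ′ * pow (x i) (k ∸ 1)))

  IsLargestHEigenvalue : ∀ {k N} → Tensor k N → Carrier → Set (c ⊔ ℓ)
  IsLargestHEigenvalue T λ′ =
    IsHEigenvalue T λ′ × (∀ μ → IsHEigenvalue T μ → μ ≤ λ′)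

  module _ (H : Hypergraph) (k : ℕ) where
    open Hypergraph H

    count : ∀ {p} → (Fin p → Bool) → ℕ
    count {zero}  f = 0
    count {suc p} f = (if f Fin.zero then 1 else 0) ℕ.+ count (λ i → f (Fin.suc i))

    anyFin : ∀ {p} → (Fin p → Bool) → Bool
    anyFin {zero}  f = false
    anyFin {suc p} f = f Fin.zero ∨ anyFin (λ i → f (Fin.suc i))

    allFin : ∀ {p} → (Fin p → Bool) → Bool
    allFin {zero}  f = true
    allFin {suc p} f = f Fin.zero ∧ allFin (λ i → f (Fin.suc i))

    memVec : ∀ {l} → Fin N → Vec (Fin N) l → Bool
    memVec v []       = false
    memVec v (i ∷ is) = (v == i) ∨ memVec v is

    boolEq : Bool → Bool → Bool
    boolEq true  b = b
    boolEq false true  = false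
    boolEq false false = true

    isEdgeIdx : Vec (Fin N) k → Bool
    isEdgeIdx is = anyFin (λ e → allFin (λ v → boolEq (edge e v) (memVec v is)))

    degree : Fin N → ℕ
    degree v = count (λ e → edge e v)

    factorial : ℕ → ℕ
    factorial zero    = 1
    factorial (suc n) = suc n ℕ.* factorial n

    adjacency : Tensor k N
    adjacency is = if isEdgeIdx is then (fromℕ (factorial (k ∸ 1))) ⁻¹ else 0#

    allEq : ∀ {l} → Fin N → Vec (Fin N) l → Bool
    allEq v []       = true
    allEq v (j ∷ js) = (v == j) ∧ allEq v js

    diagonal : Tensor k N
    diagonal []       = 0#
    diagonal (i ∷ js) = if allEq i js then fromℕ (degree i) else 0#

    laplacian : Tensor k N
    laplacian is = diagonal is - adjacency is

    signlessLaplacian : Tensor k N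
    signlessLaplacian is = diagonal is + adjacency is

-- Mark the first vertex of every block V_e; this needs V_e ≠ ∅, i.e. 2s < k.  Each edge
-- V_u ∪ V_v ∪ V_e of G^{k,s} contains exactly one marked vertex, so G^{k,s} is odd-bipartite.
-- A k-tuple whose entries form a k-element edge has pairwise distinct entries, hence exactly
-- one marked entry.  Let σ be −1 on marked vertices and 1 elsewhere.  Since k − 1 is odd,
-- the diagonal entries of 𝒟 satisfy σ_{i₂}⋯σ_{i_k} = σ_i^{k−1} = σ_i, while the edge entries
-- satisfy σ_i σ_{i₂}⋯σ_{i_k} = −1.  Hence 𝒬 = diag(σ) ℒ diag(σ)^{k−1} and vice versa, so
-- x ↦ σx carries the H-eigenvectors of ℒ to those of 𝒬 with the same eigenvalue and back:
-- the two tensors have the same H-eigenvalues, in particular the same largest one.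
module Submission where

open import Defs hiding (count)
open import Data.Nat using (ℕ; zero; suc; _*_; _∸_; _≤_; _<_)
open import Data.Product using (_×_)
open import Data.Bool using (Bool; _∧_)
open import Data.Fin using (Fin)
open import Relation.Binary.PropositionalEquality using (_≡_)

module Counting where
  open import Data.Nat using (_+_; z≤n)
  open import Data.Nat.Properties
    using ( +-identityʳ; +-assoc; *-distribʳ-+; +-mono-≤; ≤-refl; ≤-trans; ≤-reflexive
          ; 1+n≰n; suc-injective; +-commutativeSemigroup )
  open import Algebra.Properties.CommutativeSemigroup +-commutativeSemigroup using (x∙yz≈y∙xz)
  open import Data.Fin using (zero; suc; quotient; remainder; _↑ˡ_; _↑ʳ_)
  open import Data.Fin.Properties using (_≟_; splitAt-↑ˡ; splitAt-↑ʳ)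
  open import Data.Bool using (true; false; if_then_else_; _∨_; not)
  open import Data.Bool.Properties using (∧-identityʳ; ∧-zeroʳ; ∧-inverseʳ)
  open import Data.Vec using (Vec; []; _∷_)
  open import Data.Product using (_,_)
  open import Data.Empty using (⊥-elim)
  open import Function using (_∘_)
  open import Relation.Nullary using (¬_; yes; no)
  open import Relation.Binary.PropositionalEquality
  open ≡-Reasoning

  ==-refl : ∀ {p} (a : Fin p) → (a == a) ≡ true
  ==-refl a with a ≟ a
  ... | yes _   = refl
  ... | no a≢a = ⊥-elim (a≢a refl)

  ==⇒≡ : ∀ {p} {a b : Fin p} → (a == b) ≡ true → a ≡ b
  ==⇒≡ {a = a} {b} a==b with a ≟ b
  ... | yes a≡b = a≡b

  ≢⇒==-false : ∀ {p} {a b : Fin p} → ¬ a ≡ b → (a == b) ≡ false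
  ≢⇒==-false {a = a} {b} a≢b with a ≟ b
  ... | yes a≡b = ⊥-elim (a≢b a≡b)
  ... | no _    = refl

  ==-suc : ∀ {p} (a b : Fin p) → (a == b) ≡ (suc a == suc b)
  ==-suc a b with a ≟ b
  ... | yes _ = refl
  ... | no _  = refl

  𝟙 : Bool → ℕ
  𝟙 b = if b then 1 else 0

  count : ∀ {p} → (Fin p → Bool) → ℕ
  count {zero}  f = 0
  count {suc p} f = 𝟙 (f zero) + count (f ∘ suc)

  count-cong : ∀ {p} {f g : Fin p → Bool} → (∀ i → f i ≡ g i) → count f ≡ count g
  count-cong {zero}  f≗g = refl
  count-cong {suc p} f≗g = cong₂ _+_ (cong 𝟙 (f≗g zero)) (count-cong (f≗g ∘ suc))

  count-false : ∀ {p} → count {p} (λ _ → false) ≡ 0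
  count-false {zero}  = refl
  count-false {suc p} = count-false {p}

  count-true : ∀ {p} → count {p} (λ _ → true) ≡ p
  count-true {zero}  = refl
  count-true {suc p} = cong suc count-true

  count-∧-true : ∀ {p} (f : Fin p → Bool) → count (λ i → f i ∧ true) ≡ count f
  count-∧-true f = count-cong (∧-identityʳ ∘ f)

  count-∧ˡ : ∀ b {p} (f : Fin p → Bool) → count (λ i → b ∧ f i) ≡ 𝟙 b * count f
  count-∧ˡ false {p} f = count-false {p}
  count-∧ˡ true      f = sym (+-identityʳ (count f))

  count-↑ : ∀ a {b} (f : Fin (a + b) → Bool) →
            count f ≡ count (λ i → f (i ↑ˡ b)) + count (λ j → f (a ↑ʳ j))
  count-↑ zero    f = refl
  count-↑ (suc a) f =
    trans (cong (𝟙 (f zero) +_) (count-↑ a (f ∘ suc))) (sym (+-assoc (𝟙 (f zero)) _ _))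

  count-remQuot : ∀ n {s} (f : Fin n → Bool) (g : Fin s → Bool) →
                  count (λ p → f (quotient s p) ∧ g (remainder {n} s p)) ≡ count f * count g
  count-remQuot zero        f g = refl
  count-remQuot (suc n) {s} f g = begin
    count F
      ≡⟨ count-↑ s F ⟩
    count (λ j → F (j ↑ˡ n * s)) + count (λ q → F (s ↑ʳ q))
      ≡⟨ cong₂ _+_ (count-cong first) (count-cong rest) ⟩
    count (λ j → f zero ∧ g j) + count (λ q → f (suc (quotient s q)) ∧ g (remainder {n} s q))
      ≡⟨ cong₂ _+_ (count-∧ˡ (f zero) g) (count-remQuot n (f ∘ suc) g) ⟩
    𝟙 (f zero) * count g + count (f ∘ suc) * count g
      ≡⟨ *-distribʳ-+ (count g) (𝟙 (f zero)) _ ⟨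
    count f * count g
      ∎
    where
    F : Fin (suc n * s) → Bool
    F p = f (quotient s p) ∧ g (remainder {suc n} s p)
    first : ∀ j → F (j ↑ˡ n * s) ≡ (f zero ∧ g j)
    first j rewrite splitAt-↑ˡ s j (n * s) = refl
    rest : ∀ q → F (s ↑ʳ q) ≡ (f (suc (quotient s q)) ∧ g (remainder {n} s q))
    rest q rewrite splitAt-↑ʳ s (n * s) q = refl

  count-quotient : ∀ n {s} (f : Fin n → Bool) → count (λ p → f (quotient {n} s p)) ≡ count f * s
  count-quotient n {s} f = begin
    count (λ p → f (quotient {n} s p))     ≡⟨ count-∧-true (f ∘ quotient s) ⟨
    count (λ p → f (quotient s p) ∧ true)  ≡⟨ count-remQuot n f (λ _ → true) ⟩
    count f * count {s} (λ _ → true)       ≡⟨ cong (count f *_) count-true ⟩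
    count f * s                            ∎

  count-remove : ∀ {p} (a : Fin p) (f : Fin p → Bool) →
                 count f ≡ 𝟙 (f a) + count (λ x → f x ∧ not (x == a))
  count-remove zero f = cong (𝟙 (f zero) +_) (sym (cong₂ _+_
    (cong 𝟙 (∧-zeroʳ (f zero)))
    (count-∧-true (f ∘ suc))))
  count-remove (suc a) f = begin
    𝟙 (f zero) + count (f ∘ suc)
      ≡⟨ cong (𝟙 (f zero) +_) (count-remove a (f ∘ suc)) ⟩
    𝟙 (f zero) + (𝟙 (f (suc a)) + count (λ x → f (suc x) ∧ not (x == a)))
      ≡⟨ x∙yz≈y∙xz (𝟙 (f zero)) (𝟙 (f (suc a))) _ ⟩
    𝟙 (f (suc a)) + (𝟙 (f zero) + count (λ x → f (suc x) ∧ not (x == a)))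
      ≡⟨ cong (𝟙 (f (suc a)) +_) (cong₂ _+_
           (cong 𝟙 (sym (∧-identityʳ (f zero))))
           (count-cong (λ x → cong (λ b → f (suc x) ∧ not b) (==-suc x a)))) ⟩
    𝟙 (f (suc a)) + count (λ x → f x ∧ not (x == suc a))
      ∎

  count-== : ∀ {p} (a : Fin p) → count (_== a) ≡ 1
  count-== {p} a = begin
    count (_== a)
      ≡⟨ count-remove a (_== a) ⟩
    𝟙 (a == a) + count (λ x → (x == a) ∧ not (x == a))
      ≡⟨ cong₂ _+_ (cong 𝟙 (==-refl a)) (count-cong (∧-inverseʳ ∘ (_== a))) ⟩
    1 + count {p} (λ _ → false)
      ≡⟨ cong suc (count-false {p}) ⟩
    1 ∎

  count-insert : ∀ {p} (a : Fin p) (g P : Fin p → Bool) →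
                 count (λ x → ((x == a) ∨ g x) ∧ P x)
                 ≡ 𝟙 (not (g a) ∧ P a) + count (λ x → g x ∧ P x)
  count-insert a g P = begin
    count (λ x → ((x == a) ∨ g x) ∧ P x)
      ≡⟨ count-remove a _ ⟩
    𝟙 (((a == a) ∨ g a) ∧ P a) + count (λ x → (((x == a) ∨ g x) ∧ P x) ∧ not (x == a))
      ≡⟨ cong₂ _+_ (cong (λ c → 𝟙 ((c ∨ g a) ∧ P a)) (==-refl a))
                   (count-cong (λ x → drop (x == a) (g x) (P x))) ⟩
    𝟙 (P a) + count rest
      ≡⟨ split (g a) (P a) ⟩
    𝟙 (not (g a) ∧ P a) + (𝟙 (g a ∧ P a) + count rest)
      ≡⟨ cong (𝟙 (not (g a) ∧ P a) +_) (count-remove a _) ⟨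
    𝟙 (not (g a) ∧ P a) + count (λ x → g x ∧ P x)
      ∎
    where
    rest : Fin _ → Bool
    rest x = (g x ∧ P x) ∧ not (x == a)
    drop : ∀ u m q → ((u ∨ m) ∧ q) ∧ not u ≡ (m ∧ q) ∧ not u
    drop false m q = refl
    drop true  m q = trans (∧-zeroʳ q) (sym (∧-zeroʳ (m ∧ q)))
    split : ∀ b q {n} → 𝟙 q + n ≡ 𝟙 (not b ∧ q) + (𝟙 (b ∧ q) + n)
    split false q = refl
    split true  q = refl

  count-==-∨ : ∀ {p} {a b : Fin p} → ¬ a ≡ b → count (λ x → (x == a) ∨ (x == b)) ≡ 2
  count-==-∨ {a = a} {b} a≢b = begin
    count (λ x → (x == a) ∨ (x == b))
      ≡⟨ count-∧-true (λ x → (x == a) ∨ (x == b)) ⟨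
    count (λ x → ((x == a) ∨ (x == b)) ∧ true)
      ≡⟨ count-insert a (_== b) (λ _ → true) ⟩
    𝟙 (not (a == b) ∧ true) + count (λ x → (x == b) ∧ true)
      ≡⟨ cong₂ _+_ (cong (λ c → 𝟙 (not c ∧ true)) (≢⇒==-false a≢b))
                   (trans (count-∧-true (_== b)) (count-== b)) ⟩
    2 ∎

  _∈ᵇ_ : ∀ {N l} → Fin N → Vec (Fin N) l → Bool
  x ∈ᵇ []       = false
  x ∈ᵇ (a ∷ v) = (x == a) ∨ (x ∈ᵇ v)

  countEntries : ∀ {N l} → (Fin N → Bool) → Vec (Fin N) l → ℕ
  countEntries P []       = 0
  countEntries P (a ∷ v) = 𝟙 (P a) + countEntries P v

  count-∈ᵇ-∷ : ∀ {N l} (a : Fin N) (v : Vec (Fin N) l) →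
               count (_∈ᵇ (a ∷ v)) ≡ 𝟙 (not (a ∈ᵇ v)) + count (_∈ᵇ v)
  count-∈ᵇ-∷ a v = begin
    count (_∈ᵇ (a ∷ v))
      ≡⟨ count-∧-true (_∈ᵇ (a ∷ v)) ⟨
    count (λ x → (x ∈ᵇ (a ∷ v)) ∧ true)
      ≡⟨ count-insert a (_∈ᵇ v) (λ _ → true) ⟩
    𝟙 (not (a ∈ᵇ v) ∧ true) + count (λ x → (x ∈ᵇ v) ∧ true)
      ≡⟨ cong₂ _+_ (cong 𝟙 (∧-identityʳ (not (a ∈ᵇ v)))) (count-∧-true (_∈ᵇ v)) ⟩
    𝟙 (not (a ∈ᵇ v)) + count (_∈ᵇ v)
      ∎

  count-∈ᵇ-≤ : ∀ {N l} (v : Vec (Fin N) l) → count (_∈ᵇ v) ≤ l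
  count-∈ᵇ-≤ {N} []      = ≤-reflexive (count-false {N})
  count-∈ᵇ-≤     (a ∷ v) =
    ≤-trans (≤-reflexive (count-∈ᵇ-∷ a v))
            (+-mono-≤ (𝟙≤1 (not (a ∈ᵇ v))) (count-∈ᵇ-≤ v))
    where
    𝟙≤1 : ∀ b → 𝟙 b ≤ 1
    𝟙≤1 false = z≤n
    𝟙≤1 true  = ≤-refl

  distinct-∷ : ∀ {N l} (a : Fin N) (v : Vec (Fin N) l) → count (_∈ᵇ (a ∷ v)) ≡ suc l →
               (a ∈ᵇ v) ≡ false × count (_∈ᵇ v) ≡ l
  distinct-∷ {l = l} a v distinct =
    new-and-distinct (a ∈ᵇ v) (trans (sym (count-∈ᵇ-∷ a v)) distinct) (count-∈ᵇ-≤ v)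
    where
    new-and-distinct : ∀ b {c} → 𝟙 (not b) + c ≡ suc l → c ≤ l → b ≡ false × c ≡ l
    new-and-distinct false c≡l   _   = refl , suc-injective c≡l
    new-and-distinct true  c≡1+l c≤l = ⊥-elim (1+n≰n (subst (_≤ l) c≡1+l c≤l))

  countEntries-distinct : ∀ {N l} (P : Fin N → Bool) (v : Vec (Fin N) l) → count (_∈ᵇ v) ≡ l →
                          countEntries P v ≡ count (λ x → (x ∈ᵇ v) ∧ P x)
  countEntries-distinct {N} P []      _        = sym (count-false {N})
  countEntries-distinct      P (a ∷ v) distinct with distinct-∷ a v distinct
  ... | a∉v , v-distinct = begin
    𝟙 (P a) + countEntries P v
      ≡⟨ cong (𝟙 (P a) +_) (countEntries-distinct P v v-distinct) ⟩
    𝟙 (P a) + count (λ x → (x ∈ᵇ v) ∧ P x)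
      ≡⟨ cong (λ b → 𝟙 (not b ∧ P a) + count (λ x → (x ∈ᵇ v) ∧ P x)) a∉v ⟨
    𝟙 (not (a ∈ᵇ v) ∧ P a) + count (λ x → (x ∈ᵇ v) ∧ P x)
      ≡⟨ count-insert a (_∈ᵇ v) P ⟨
    count (λ x → (x ∈ᵇ (a ∷ v)) ∧ P x)
      ∎

open Counting

data Odd : ℕ → Set where
  one : Odd 1
  2+_ : ∀ {n} → Odd n → Odd (suc (suc n))

odd-2*suc∸1 : ∀ r → Odd (2 * suc r ∸ 1)
odd-2*suc∸1 zero    = one
odd-2*suc∸1 (suc r) = subst Odd (cong suc (sym (+-suc r (suc (r + 0))))) (2+ odd-2*suc∸1 r)
  where
  open import Data.Nat using (_+_)
  open import Data.Nat.Properties using (+-suc)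
  open import Relation.Binary.PropositionalEquality using (subst; cong; sym)

IsUniform : Hypergraph → ℕ → Set
IsUniform H k = ∀ e → count (edge e) ≡ k
  where open Hypergraph H

IsOddBipartite : (H : Hypergraph) → (Fin (Hypergraph.N H) → Bool) → Set
IsOddBipartite H P = ∀ e → Odd (count (λ w → edge e w ∧ P w))
  where open Hypergraph H

module PowerHypergraph (G : SimpleGraph) (k s : ℕ) where
  open import Data.Nat using (_+_)
  open import Data.Nat.Properties using (*-identityˡ; m+[n∸m]≡n; m<n⇒0<n∸m)
  open import Data.Fin using (zero; suc; splitAt; quotient; remainder; _↑ˡ_; _↑ʳ_)
  open import Data.Fin.Properties using (splitAt-↑ˡ; splitAt-↑ʳ)
  open import Data.Bool using (true; false; _∨_)
  open import Data.Bool.Properties using (∧-zeroʳ)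
  open import Data.Sum using (inj₁; inj₂)
  open import Data.Product using (proj₁; proj₂)
  open import Relation.Binary.PropositionalEquality using (refl; sym; trans; cong; cong₂; subst)
  open Relation.Binary.PropositionalEquality.≡-Reasoning
  open SimpleGraph G
  open Hypergraph (powerHG G k s) using (edge)

  t : ℕ
  t = k ∸ 2 * s

  isEndOf : Fin m → Fin n → Bool
  isEndOf e v = (v == proj₁ (ends e)) ∨ (v == proj₂ (ends e))

  isZero : ∀ {p} → Fin p → Bool
  isZero zero    = true
  isZero (suc _) = false

  count-isZero : ∀ {p} → 0 < p → count (isZero {p}) ≡ 1
  count-isZero {suc p} _ = cong suc (count-false {p})

  isFirstOfVₑ : Fin (n * s + m * t) → Bool
  isFirstOfVₑ w with splitAt (n * s) w
  ... | inj₁ _ = false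
  ... | inj₂ q = isZero (remainder {m} t q)

  edge-↑ˡ : ∀ e p → edge e (p ↑ˡ m * t) ≡ isEndOf e (quotient s p)
  edge-↑ˡ e p rewrite splitAt-↑ˡ (n * s) p (m * t) = refl

  edge-↑ʳ : ∀ e q → edge e (n * s ↑ʳ q) ≡ (quotient t q == e)
  edge-↑ʳ e q rewrite splitAt-↑ʳ (n * s) (m * t) q = refl

  isFirstOfVₑ-↑ˡ : ∀ p → isFirstOfVₑ (p ↑ˡ m * t) ≡ false
  isFirstOfVₑ-↑ˡ p rewrite splitAt-↑ˡ (n * s) p (m * t) = refl

  isFirstOfVₑ-↑ʳ : ∀ q → isFirstOfVₑ (n * s ↑ʳ q) ≡ isZero (remainder {m} t q)
  isFirstOfVₑ-↑ʳ q rewrite splitAt-↑ʳ (n * s) (m * t) q = refl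

  powerHG-uniform : 2 * s ≤ k → IsUniform (powerHG G k s) k
  powerHG-uniform 2s≤k e = begin
    count (edge e)
      ≡⟨ count-↑ (n * s) (edge e) ⟩
    count (λ p → edge e (p ↑ˡ m * t)) + count (λ q → edge e (n * s ↑ʳ q))
      ≡⟨ cong₂ _+_ (count-cong (edge-↑ˡ e)) (count-cong (edge-↑ʳ e)) ⟩
    count (λ p → isEndOf e (quotient s p)) + count (λ q → quotient t q == e)
      ≡⟨ cong₂ _+_ (count-quotient n (isEndOf e)) (count-quotient m (_== e)) ⟩
    count (isEndOf e) * s + count (_== e) * t
      ≡⟨ cong₂ _+_ (cong (_* s) (count-==-∨ (loopless e))) (cong (_* t) (count-== e)) ⟩
    2 * s + 1 * t
      ≡⟨ cong (2 * s +_) (*-identityˡ t) ⟩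
    2 * s + t
      ≡⟨ m+[n∸m]≡n 2s≤k ⟩
    k ∎

  powerHG-oddBipartite : 2 * s < k → IsOddBipartite (powerHG G k s) isFirstOfVₑ
  powerHG-oddBipartite 2s<k e = subst Odd (sym count-firsts) one
    where
    count-firsts : count (λ w → edge e w ∧ isFirstOfVₑ w) ≡ 1
    count-firsts = begin
      count (λ w → edge e w ∧ isFirstOfVₑ w)
        ≡⟨ count-↑ (n * s) _ ⟩
      count (λ p → edge e (p ↑ˡ m * t) ∧ isFirstOfVₑ (p ↑ˡ m * t))
        + count (λ q → edge e (n * s ↑ʳ q) ∧ isFirstOfVₑ (n * s ↑ʳ q))
        ≡⟨ cong₂ _+_
             (count-cong (λ p → trans (cong (edge e (p ↑ˡ m * t) ∧_) (isFirstOfVₑ-↑ˡ p))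
                                      (∧-zeroʳ _)))
             (count-cong (λ q → cong₂ _∧_ (edge-↑ʳ e q) (isFirstOfVₑ-↑ʳ q))) ⟩
      count {n * s} (λ _ → false) + count (λ q → (quotient t q == e) ∧ isZero (remainder {m} t q))
        ≡⟨ cong₂ _+_ (count-false {n * s}) (count-remQuot m (_== e) isZero) ⟩
      count (_== e) * count (isZero {t})
        ≡⟨ cong₂ _*_ (count-== e) (count-isZero (m<n⇒0<n∸m 2s<k)) ⟩
      1 ∎

module HEigenvalues {c ℓ} (R : RealField c ℓ) where
  open import Data.Fin using (zero; suc)
  open import Data.Bool using (true; false; if_then_else_; _∨_)
  open import Data.Vec using (Vec; []; _∷_; replicate)
  open import Data.Product using (∃; _,_; proj₁; proj₂; map)
  open import Function using (_∘_; id)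
  open import Relation.Nullary using (¬_)
  import Relation.Binary.PropositionalEquality as ≡
  open RealField R hiding (_≤_; zero) renaming (_*_ to _·_)
  open import Algebra.Properties.Ring ring
    using (-1*x≈-x; -‿involutive; -‿distribˡ-*; -‿distribʳ-*; -0#≈0#)
  open import Algebra.Properties.CommutativeSemigroup *-commutativeSemigroup
    using (interchange; x∙yz≈y∙xz)
  open import Relation.Binary.Reasoning.Setoid setoid

  ΣFin-cong : ∀ n {f g : Fin n → Carrier} → (∀ i → f i ≈ g i) → ΣFin R n f ≈ ΣFin R n g
  ΣFin-cong zero    f≈g = refl
  ΣFin-cong (suc n) f≈g = +-cong (f≈g zero) (ΣFin-cong n (f≈g ∘ suc))

  ΣIdx-cong : ∀ N m {f g : Vec (Fin N) m → Carrier} → (∀ v → f v ≈ g v) →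
              ΣIdx R N m f ≈ ΣIdx R N m g
  ΣIdx-cong N zero    f≈g = f≈g []
  ΣIdx-cong N (suc m) f≈g = ΣFin-cong N (λ i → ΣIdx-cong N m (f≈g ∘ (i ∷_)))

  *-distribˡ-ΣFin : ∀ n a (f : Fin n → Carrier) → a · ΣFin R n f ≈ ΣFin R n (λ i → a · f i)
  *-distribˡ-ΣFin zero    a f = zeroʳ a
  *-distribˡ-ΣFin (suc n) a f = trans (distribˡ a _ _) (+-congˡ (*-distribˡ-ΣFin n a (f ∘ suc)))

  *-distribˡ-ΣIdx : ∀ N m a (f : Vec (Fin N) m → Carrier) →
                    a · ΣIdx R N m f ≈ ΣIdx R N m (λ v → a · f v)
  *-distribˡ-ΣIdx N zero    a f = refl
  *-distribˡ-ΣIdx N (suc m) a f =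
    trans (*-distribˡ-ΣFin N a _) (ΣFin-cong N (λ i → *-distribˡ-ΣIdx N m a (f ∘ (i ∷_))))

  prodIdx-· : ∀ {N l} (σ x : Fin N → Carrier) (v : Vec (Fin N) l) →
              prodIdx R (λ w → σ w · x w) v ≈ prodIdx R σ v · prodIdx R x v
  prodIdx-· σ x []      = sym (*-identityˡ 1#)
  prodIdx-· σ x (i ∷ v) = trans (*-congˡ (prodIdx-· σ x v)) (interchange (σ i) (x i) _ _)

  prodIdx-replicate : ∀ {N} (σ : Fin N → Carrier) l i →
                      prodIdx R σ (replicate l i) ≡.≡ pow R (σ i) l
  prodIdx-replicate σ zero    i = ≡.refl
  prodIdx-replicate σ (suc l) i = ≡.cong (σ i ·_) (prodIdx-replicate σ l i)

  pow-· : ∀ a b n → pow R (a · b) n ≈ pow R a n · pow R b n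
  pow-· a b zero    = sym (*-identityˡ 1#)
  pow-· a b (suc n) = trans (*-congˡ (pow-· a b n)) (interchange a b _ _)

  pow-odd : ∀ {a} → a · a ≈ 1# → ∀ {n} → Odd n → pow R a n ≈ a
  pow-odd {a} a²≈1 one             = *-identityʳ a
  pow-odd {a} a²≈1 (2+_ {n} n-odd) = begin
    a · (a · pow R a n)  ≈⟨ *-assoc a a _ ⟨
    (a · a) · pow R a n  ≈⟨ *-cong a²≈1 (pow-odd a²≈1 n-odd) ⟩
    1# · a               ≈⟨ *-identityˡ a ⟩
    a                    ∎

  cancel-square : ∀ {a} → a · a ≈ 1# → ∀ x → a · (a · x) ≈ x
  cancel-square {a} a²≈1 x = trans (sym (*-assoc a a x)) (trans (*-congʳ a²≈1) (*-identityˡ x))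

  sign : Bool → Carrier
  sign b = if b then - 1# else 1#

  -1²≈1 : - 1# · - 1# ≈ 1#
  -1²≈1 = trans (-1*x≈-x (- 1#)) (-‿involutive 1#)

  sign-squared : ∀ b → sign b · sign b ≈ 1#
  sign-squared true  = -1²≈1
  sign-squared false = *-identityˡ 1#

  prodIdx-sign : ∀ {N l} (P : Fin N → Bool) (v : Vec (Fin N) l) →
                 prodIdx R (sign ∘ P) v ≈ pow R (- 1#) (countEntries P v)
  prodIdx-sign P []      = refl
  prodIdx-sign P (i ∷ v) with P i
  ... | true  = *-congˡ (prodIdx-sign P v)
  ... | false = trans (*-identityˡ _) (prodIdx-sign P v)

  -- For σ² = 1 this says t′_{i i₂⋯i_k} = σ_i σ_{i₂}⋯σ_{i_k} t_{i i₂⋯i_k}, i.e.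
  -- T′ = diag(σ) T diag(σ)^{k−1}.
  SignSimilar : ∀ {k′ N} → (Fin N → Carrier) →
                Tensor R (suc k′) N → Tensor R (suc k′) N → Set ℓ
  SignSimilar σ T T′ = ∀ i js → T′ (i ∷ js) · prodIdx R σ js ≈ σ i · T (i ∷ js)

  IsHEigenvalue-signSimilar : ∀ {k′ N} {σ : Fin N → Carrier} {T T′ : Tensor R (suc k′) N} →
                              (∀ w → σ w · σ w ≈ 1#) → Odd k′ → SignSimilar σ T T′ →
                              ∀ {μ} → IsHEigenvalue R T μ → IsHEigenvalue R T′ μ
  IsHEigenvalue-signSimilar {k′} {N} {σ} {T} {T′} σ²≈1 k′-odd similar {μ}
                            (x , (i₀ , xi₀≉0) , eigen) = y , (i₀ , yi₀≉0) , eigen′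
    where
    y : Fin N → Carrier
    y w = σ w · x w

    yi₀≉0 : ¬ (y i₀ ≈ 0#)
    yi₀≉0 yi₀≈0 = xi₀≉0 (begin
      x i₀         ≈⟨ cancel-square (σ²≈1 i₀) (x i₀) ⟨
      σ i₀ · y i₀  ≈⟨ *-congˡ yi₀≈0 ⟩
      σ i₀ · 0#    ≈⟨ zeroʳ (σ i₀) ⟩
      0#           ∎)

    entry : ∀ i js → T′ (i ∷ js) · prodIdx R y js ≈ σ i · (T (i ∷ js) · prodIdx R x js)
    entry i js = begin
      T′ (i ∷ js) · prodIdx R y js                     ≈⟨ *-congˡ (prodIdx-· σ x js) ⟩
      T′ (i ∷ js) · (prodIdx R σ js · prodIdx R x js)  ≈⟨ *-assoc _ _ _ ⟨
      (T′ (i ∷ js) · prodIdx R σ js) · prodIdx R x js  ≈⟨ *-congʳ (similar i js) ⟩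
      (σ i · T (i ∷ js)) · prodIdx R x js              ≈⟨ *-assoc _ _ _ ⟩
      σ i · (T (i ∷ js) · prodIdx R x js)              ∎

    eigen′ : ∀ i → apply R T′ y i ≈ μ · pow R (y i) k′
    eigen′ i = begin
      ΣIdx R N k′ (λ js → T′ (i ∷ js) · prodIdx R y js)
        ≈⟨ ΣIdx-cong N k′ (entry i) ⟩
      ΣIdx R N k′ (λ js → σ i · (T (i ∷ js) · prodIdx R x js))
        ≈⟨ *-distribˡ-ΣIdx N k′ (σ i) _ ⟨
      σ i · apply R T x i
        ≈⟨ *-congˡ (eigen i) ⟩
      σ i · (μ · pow R (x i) k′)
        ≈⟨ x∙yz≈y∙xz (σ i) μ _ ⟩
      μ · (σ i · pow R (x i) k′)
        ≈⟨ *-congˡ (*-congʳ (pow-odd (σ²≈1 i) k′-odd)) ⟨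
      μ · (pow R (σ i) k′ · pow R (x i) k′)
        ≈⟨ *-congˡ (pow-· (σ i) (x i) k′) ⟨
      μ · pow R (y i) k′
        ∎

  IsLargestHEigenvalue-transfer : ∀ {k N} {T T′ : Tensor R k N} →
                                  (∀ {μ} → IsHEigenvalue R T μ → IsHEigenvalue R T′ μ) →
                                  (∀ {μ} → IsHEigenvalue R T′ μ → IsHEigenvalue R T μ) →
                                  ∀ {λ′} → IsLargestHEigenvalue R T λ′ →
                                  IsLargestHEigenvalue R T′ λ′
  IsLargestHEigenvalue-transfer T⇒T′ T′⇒T (eigen , largest) =
    T⇒T′ eigen , λ μ → largest μ ∘ T′⇒T

  ±-signSimilar : ∀ {d a π s} → d · π ≈ s · d → a · π ≈ - (s · a) →
                  (d + a) · π ≈ s · (d - a) × (d - a) · π ≈ s · (d + a)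
  ±-signSimilar {d} {a} {π} {s} dπ≈sd aπ≈-sa = plus , minus
    where
    plus : (d + a) · π ≈ s · (d - a)
    plus = begin
      (d + a) · π        ≈⟨ distribʳ π d a ⟩
      d · π + a · π      ≈⟨ +-cong dπ≈sd aπ≈-sa ⟩
      s · d + - (s · a)  ≈⟨ +-congˡ (-‿distribʳ-* s a) ⟩
      s · d + s · - a    ≈⟨ distribˡ s d (- a) ⟨
      s · (d - a)        ∎
    minus : (d - a) · π ≈ s · (d + a)
    minus = begin
      (d - a) · π          ≈⟨ distribʳ π d (- a) ⟩
      d · π + - a · π      ≈⟨ +-cong dπ≈sd (sym (-‿distribˡ-* a π)) ⟩
      s · d + - (a · π)    ≈⟨ +-congˡ (-‿cong aπ≈-sa) ⟩
      s · d + - - (s · a)  ≈⟨ +-congˡ (-‿involutive (s · a)) ⟩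
      s · d + s · a        ≈⟨ distribˡ s d a ⟨
      s · (d + a)          ∎

  module EdgeIndices (H : Hypergraph) (k : ℕ) where
    open Hypergraph H

    anyFin-true : ∀ {p} (f : Fin p → Bool) → anyFin R H k f ≡.≡ true → ∃ λ i → f i ≡.≡ true
    anyFin-true {suc p} f any with f zero in f₀
    ... | true  = zero , f₀
    ... | false = map suc id (anyFin-true (f ∘ suc) any)

    allFin-true : ∀ {p} (f : Fin p → Bool) → allFin R H k f ≡.≡ true → ∀ i → f i ≡.≡ true
    allFin-true {suc p} f all i with f zero in f₀
    allFin-true {suc p} f all zero    | true = f₀
    allFin-true {suc p} f all (suc i) | true = allFin-true (f ∘ suc) all i

    boolEq-true : ∀ a b → boolEq R H k a b ≡.≡ true → a ≡.≡ b
    boolEq-true true  true  _ = ≡.refl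
    boolEq-true false false _ = ≡.refl

    memVec≡∈ᵇ : ∀ {l} w (is : Vec (Fin N) l) → memVec R H k w is ≡.≡ (w ∈ᵇ is)
    memVec≡∈ᵇ w []       = ≡.refl
    memVec≡∈ᵇ w (i ∷ is) = ≡.cong ((w == i) ∨_) (memVec≡∈ᵇ w is)

    isEdgeIdx⇒edge : ∀ is → isEdgeIdx R H k is ≡.≡ true →
                     ∃ λ e → ∀ w → edge e w ≡.≡ (w ∈ᵇ is)
    isEdgeIdx⇒edge is is-edge =
      map id (λ all w → ≡.trans (boolEq-true _ _ (allFin-true _ all w)) (memVec≡∈ᵇ w is))
             (anyFin-true _ is-edge)

    allEq⇒replicate : ∀ {l} i (js : Vec (Fin N) l) → allEq R H k i js ≡.≡ true →
                      js ≡.≡ replicate l i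
    allEq⇒replicate i []       _   = ≡.refl
    allEq⇒replicate i (j ∷ js) all with i == j in i==j | allEq R H k i js in rest
    ... | true | true = ≡.cong₂ _∷_ (≡.sym (==⇒≡ i==j)) (allEq⇒replicate i js rest)

  module OddBipartite (H : Hypergraph) {k′} (k′-odd : Odd k′) (uniform : IsUniform H (suc k′))
                      (P : Fin (Hypergraph.N H) → Bool) (oddBipartite : IsOddBipartite H P) where
    open Hypergraph H
    open EdgeIndices H (suc k′)

    k : ℕ
    k = suc k′

    σ : Fin N → Carrier
    σ = sign ∘ P

    prodIdx-edge : ∀ is → isEdgeIdx R H k is ≡.≡ true → prodIdx R σ is ≈ - 1#
    prodIdx-edge is is-edge with isEdgeIdx⇒edge is is-edge
    ... | e , e≗is = begin
      prodIdx R σ is                    ≈⟨ prodIdx-sign P is ⟩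
      pow R (- 1#) (countEntries P is)  ≈⟨ pow-odd -1²≈1 (≡.subst Odd entries≡edge (oddBipartite e)) ⟩
      - 1#                              ∎
      where
      distinct : count (_∈ᵇ is) ≡.≡ k
      distinct = ≡.trans (count-cong (≡.sym ∘ e≗is)) (uniform e)
      entries≡edge : count (λ w → edge e w ∧ P w) ≡.≡ countEntries P is
      entries≡edge = ≡.sym (≡.trans (countEntries-distinct P is distinct)
                                    (count-cong (λ w → ≡.cong (_∧ P w) (≡.sym (e≗is w)))))

    diagonal-sign : ∀ i js →
                    diagonal R H k (i ∷ js) · prodIdx R σ js ≈ σ i · diagonal R H k (i ∷ js)
    diagonal-sign i js with allEq R H k i js in all
    ... | true  = trans (*-congˡ σ-js) (*-comm _ (σ i))
      where
      σ-js : prodIdx R σ js ≈ σ i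
      σ-js = trans (reflexive (≡.trans (≡.cong (prodIdx R σ) (allEq⇒replicate i js all))
                                       (prodIdx-replicate σ k′ i)))
                   (pow-odd (sign-squared (P i)) k′-odd)
    ... | false = trans (zeroˡ _) (sym (zeroʳ (σ i)))

    adjacency-sign : ∀ i js →
                     adjacency R H k (i ∷ js) · prodIdx R σ js ≈ - (σ i · adjacency R H k (i ∷ js))
    adjacency-sign i js with isEdgeIdx R H k (i ∷ js) in is-edge
    ... | true  = trans (*-congˡ σ-js)
                        (trans (sym (-‿distribʳ-* _ (σ i))) (-‿cong (*-comm _ (σ i))))
      where
      σ-js : prodIdx R σ js ≈ - σ i
      σ-js = begin
        prodIdx R σ js                ≈⟨ cancel-square (sign-squared (P i)) _ ⟨
        σ i · (σ i · prodIdx R σ js)  ≈⟨ *-congˡ (prodIdx-edge (i ∷ js) is-edge) ⟩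
        σ i · - 1#                    ≈⟨ *-comm (σ i) (- 1#) ⟩
        - 1# · σ i                    ≈⟨ -1*x≈-x (σ i) ⟩
        - σ i                         ∎
    ... | false = trans (zeroˡ _) (trans (sym -0#≈0#) (-‿cong (sym (zeroʳ (σ i)))))

    laplacian-signSimilar : SignSimilar σ (laplacian R H k) (signlessLaplacian R H k)
    laplacian-signSimilar i js = proj₁ (±-signSimilar (diagonal-sign i js) (adjacency-sign i js))

    signlessLaplacian-signSimilar : SignSimilar σ (signlessLaplacian R H k) (laplacian R H k)
    signlessLaplacian-signSimilar i js = proj₂ (±-signSimilar (diagonal-sign i js) (adjacency-sign i js))

    IsHEigenvalue-laplacian⇒signlessLaplacian : ∀ {μ} → IsHEigenvalue R (laplacian R H k) μ →
                                                IsHEigenvalue R (signlessLaplacian R H k) μ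
    IsHEigenvalue-laplacian⇒signlessLaplacian =
      IsHEigenvalue-signSimilar {T = laplacian R H k} {signlessLaplacian R H k}
                                (sign-squared ∘ P) k′-odd laplacian-signSimilar

    IsHEigenvalue-signlessLaplacian⇒laplacian : ∀ {μ} → IsHEigenvalue R (signlessLaplacian R H k) μ →
                                                IsHEigenvalue R (laplacian R H k) μ
    IsHEigenvalue-signlessLaplacian⇒laplacian =
      IsHEigenvalue-signSimilar {T = signlessLaplacian R H k} {laplacian R H k}
                                (sign-squared ∘ P) k′-odd signlessLaplacian-signSimilar

    IsLargestHEigenvalue-laplacian⇔signlessLaplacian : ∀ λ′ →
      (IsLargestHEigenvalue R (laplacian R H k) λ′ →
        IsLargestHEigenvalue R (signlessLaplacian R H k) λ′) ×
      (IsLargestHEigenvalue R (signlessLaplacian R H k) λ′ →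
        IsLargestHEigenvalue R (laplacian R H k) λ′)
    IsLargestHEigenvalue-laplacian⇔signlessLaplacian _ =
      IsLargestHEigenvalue-transfer {T = laplacian R H k} {signlessLaplacian R H k}
        IsHEigenvalue-laplacian⇒signlessLaplacian IsHEigenvalue-signlessLaplacian⇒laplacian ,
      IsLargestHEigenvalue-transfer {T = signlessLaplacian R H k} {laplacian R H k}
        IsHEigenvalue-signlessLaplacian⇒laplacian IsHEigenvalue-laplacian⇒signlessLaplacian

lemma4p1 : ∀ {c ℓ} (R : RealField c ℓ) (G : SimpleGraph) (r s : ℕ) →
    3 ≤ 2 * r → 1 ≤ s → s < r →
    ∀ λ′ →
      (IsLargestHEigenvalue R (laplacian R (powerHG G (2 * r) s) (2 * r)) λ′ →
        IsLargestHEigenvalue R (signlessLaplacian R (powerHG G (2 * r) s) (2 * r)) λ′)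
      × (IsLargestHEigenvalue R (signlessLaplacian R (powerHG G (2 * r) s) (2 * r)) λ′ →
        IsLargestHEigenvalue R (laplacian R (powerHG G (2 * r) s) (2 * r)) λ′)
lemma4p1 R G zero    s _ _ ()
lemma4p1 R G (suc r) s _ _ s<r = IsLargestHEigenvalue-laplacian⇔signlessLaplacian
  where
  open import Data.Nat.Properties using (*-monoʳ-<; <⇒≤)
  open PowerHypergraph G (2 * suc r) s using (isFirstOfVₑ; powerHG-uniform; powerHG-oddBipartite)
  2s<k : 2 * s < 2 * suc r
  2s<k = *-monoʳ-< 2 s<r
  open HEigenvalues.OddBipartite R (powerHG G (2 * suc r) s) (odd-2*suc∸1 r)
                                 (powerHG-uniform (<⇒≤ 2s<k)) isFirstOfVₑ (powerHG-oddBipartite 2s<k)
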